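{- Let $G=(V,E)$ be a finite simple graph whose vertex set is partitioned into sets $V_1,\dots,V_t$ ($t$ a positive integer), each of which is a set of true twins, and let $m_i=|V_i|$ for $1\leq i\leq t$. Let $\Gamma$ be an Abelian group of order $m$ with $\sum_{i=1}^t m_i=m-1$. If $\Gamma^*$ can be partitioned into pairwise disjoint subsets $S_1,\dots,S_t$ with $|S_i|=m_i$ and $\sum_{s\in S_i}s=0$ for every $i$, then $G$ has a $\Gamma^*$-distance anti-magic labeling.
   Context: $\Gamma$ is written additively and $\Gamma^*=\Gamma\setminus\{0\}$. A set of true twins in $G$ is a set of pairwise adjacent vertices all having the same closed neighborhood $N[\cdot]=N(\cdot)\cup\{\cdot\}$. A $\Gamma^*$-distance anti-magic labeling of $G$ is a bijection $\ell\colon V\to\Gamma^*$ such that the weights $w(v)=\sum_{u\in N(v)}\ell(u)$ are pairwise distinct for $v\in V$ (here $N(v)$ is the open neighborhood). -}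

module Defs where

open import Data.Nat using (ℕ; suc)
open import Data.Fin using (Fin)
open import Data.Fin.Properties using (_≟_)
open import Data.Bool using (Bool; true; false; T; T?)
open import Data.List using (List; []; _∷_; filter; length; map; sum; foldr)
open import Data.List.Base using (allFin)
open import Data.Product using (_×_; Σ; _,_)
open import Data.Sum using (_⊎_)
open import Function.Bundles using (_⇔_)
open import Relation.Nullary using (¬_; Dec)
open import Relation.Nullary.Decidable using (¬?)
open import Relation.Unary using (Decidable)
open import Relation.Binary.PropositionalEquality using (_≡_; _≢_)

record SimpleGraph (n : ℕ) : Set where
  field
    adj     : Fin n → Fin n → Bool
    symm    : ∀ u v → adj u v ≡ adj v u
    irrefl  : ∀ v → adj v v ≡ false
open SimpleGraph public

Adj : ∀ {n} → SimpleGraph n → Fin n → Fin n → Set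
Adj G u v = T (adj G u v)

InClosedNbhd : ∀ {n} → SimpleGraph n → Fin n → Fin n → Set
InClosedNbhd G v w = (w ≡ v) ⊎ Adj G v w

IsTrueTwinSet : ∀ {n} → SimpleGraph n → (Fin n → Set) → Set
IsTrueTwinSet G X =
  ∀ u v → X u → X v → u ≢ v →
    Adj G u v × (∀ w → InClosedNbhd G u w ⇔ InClosedNbhd G v w)

sumG : ∀ {m} → (Fin m → Fin m → Fin m) → Fin m → List (Fin m) → Fin m
sumG _+_ 0# xs = foldr _+_ 0# xs

nbhd : ∀ {n} → SimpleGraph n → Fin n → List (Fin n)
nbhd {n} G v = filter (λ u → T? (adj G v u)) (allFin n)

weight : ∀ {n m} → SimpleGraph n → (Fin m → Fin m → Fin m) → Fin m →
         (Fin n → Fin m) → Fin n → Fin m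
weight G _+_ 0# ℓ v = sumG _+_ 0# (map ℓ (nbhd G v))

IsDistanceAntiMagic : ∀ {n m} → SimpleGraph n → (Fin m → Fin m → Fin m) →
                      Fin m → (Fin n → Fin m) → Set
IsDistanceAntiMagic {n} {m} G _+_ 0# ℓ =
  (∀ u v → ℓ u ≡ ℓ v → u ≡ v) ×
  (∀ v → ℓ v ≢ 0#) ×
  (∀ (g : Fin m) → g ≢ 0# → Σ (Fin n) (λ v → ℓ v ≡ g)) ×
  (∀ u v → weight G _+_ 0# ℓ u ≡ weight G _+_ 0# ℓ v → u ≡ v)

partSize : ∀ {n t} → (Fin n → Fin t) → Fin t → ℕ
partSize {n} part i = length (filter (λ v → part v ≟ i) (allFin n))

-- S_i = { g ∈ Γ* | S g = i } as a list, for an assignment S : Fin m → Fin t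
-- (the value of S at 0 is irrelevant)
partElems : ∀ {m t} → Fin m → (Fin m → Fin t) → Fin t → List (Fin m)
partElems {m} 0# S i =
  filter (λ g → S g ≟ i) (filter (λ g → ¬? (g ≟ 0#)) (allFin m))

-- Label each twin class V_i bijectively by the block S_i. A closed
-- neighbourhood N[v] is a union of whole twin classes, and every class
-- sums to 0, so ℓ(v) + w(v) = Σ_{u ∈ N[v]} ℓ(u) = 0. Hence w(v) = -ℓ(v),
-- and distinct labels give distinct weights.
module Submission where

open import Defs
open import Algebra.Bundles using (Group)
open import Algebra.Structures using (IsAbelianGroup; IsCommutativeMonoid)
import Algebra.Properties.Group as GroupProperties
open import Data.Bool using (T; true; false; if_then_else_)
open import Data.Empty using (⊥-elim)
open import Data.Fin using (Fin)
open import Data.Fin.Properties using (_≟_; any?)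
open import Data.List using (List; []; _∷_; filter; foldr; length; map)
open import Data.List.Base using (allFin)
open import Data.List.Properties using (map-cong-local)
open import Data.List.Membership.Propositional using (_∈_)
open import Data.List.Membership.Propositional.Properties
  using (∈-allFin; ∈-filter⁺; ∈-filter⁻; ∈-map⁺; ∈-map⁻)
open import Data.List.Relation.Unary.All as All using (All; _∷_)
open import Data.List.Relation.Unary.AllPairs using (_∷_)
open import Data.List.Relation.Unary.Any using (here; there)
open import Data.List.Relation.Unary.Unique.Propositional using (Unique)
import Data.List.Relation.Unary.Unique.Propositional.Properties as Unique
open import Data.Nat using (ℕ; _+_; _≤_)
open import Data.Nat.ListAction using (sum)
open import Data.Nat.Properties using (suc-injective)
open import Data.Product using (Σ; _×_; _,_; proj₁; proj₂)
open import Data.Sum using (inj₁; inj₂)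
open import Function.Bundles using (Equivalence)
open import Relation.Binary.Definitions using (DecidableEquality)
open import Relation.Binary.PropositionalEquality
  using (_≡_; _≢_; refl; sym; trans; cong; cong₂; subst; ≢-sym; module ≡-Reasoning)
open import Relation.Nullary using (yes; no; ¬_; does)
open import Relation.Nullary.Decidable using (_×-dec_; _⊎-dec_; T?; ¬?)
open import Relation.Unary using (Decidable)

Unique-map⇒injectiveOn : ∀ {A B : Set} {f : A → B} {xs : List A} {u v : A} →
  Unique (map f xs) → u ∈ xs → v ∈ xs → f u ≡ f v → u ≡ v
Unique-map⇒injectiveOn _ (here refl) (here refl) _ = refl
Unique-map⇒injectiveOn {f = f} (fx∉ ∷ _) (here refl) (there v∈) fu≡fv =
  ⊥-elim (All.lookup fx∉ (∈-map⁺ f v∈) fu≡fv)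
Unique-map⇒injectiveOn {f = f} (fx∉ ∷ _) (there u∈) (here refl) fu≡fv =
  ⊥-elim (All.lookup fx∉ (∈-map⁺ f u∈) (sym fu≡fv))
Unique-map⇒injectiveOn (_ ∷ unique) (there u∈) (there v∈) fu≡fv =
  Unique-map⇒injectiveOn unique u∈ v∈ fu≡fv

module Relabel {A B : Set} (_≟ᴬ_ : DecidableEquality A) (default : B) where

  relabel : List A → List B → A → B
  relabel []       _        _ = default
  relabel (_ ∷ _)  []       _ = default
  relabel (x ∷ xs) (y ∷ ys) a = if does (a ≟ᴬ x) then y else relabel xs ys a

  relabel-head : ∀ {x y xs ys} → relabel (x ∷ xs) (y ∷ ys) x ≡ y
  relabel-head {x} with x ≟ᴬ x
  ... | yes _   = refl
  ... | no x≢x = ⊥-elim (x≢x refl)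

  relabel-tail : ∀ {x y xs ys a} → a ≢ x → relabel (x ∷ xs) (y ∷ ys) a ≡ relabel xs ys a
  relabel-tail {x} {a = a} a≢x with a ≟ᴬ x
  ... | yes a≡x = ⊥-elim (a≢x a≡x)
  ... | no _    = refl

  map-relabel : ∀ {xs ys} → Unique xs → length xs ≡ length ys → map (relabel xs ys) xs ≡ ys
  map-relabel {[]}     {[]}     _             _   = refl
  map-relabel {x ∷ xs} {y ∷ ys} (x∉xs ∷ uniq) len = cong₂ _∷_ (relabel-head {xs = xs} {ys}) (begin
    map (relabel (x ∷ xs) (y ∷ ys)) xs ≡⟨ map-cong-local (All.map (λ x≢a → relabel-tail {xs = xs} {ys} (≢-sym x≢a)) x∉xs) ⟩
    map (relabel xs ys) xs             ≡⟨ map-relabel uniq (suc-injective len) ⟩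
    ys                                 ∎)
    where open ≡-Reasoning

fibre : ∀ {n t} → (Fin n → Fin t) → Fin t → List (Fin n)
fibre {n} part j = filter (λ v → part v ≟ j) (allFin n)

module _ {n t} (part : Fin n → Fin t) where

  ∈-fibre⁺ : ∀ {v j} → part v ≡ j → v ∈ fibre part j
  ∈-fibre⁺ {v} {j} = ∈-filter⁺ (λ u → part u ≟ j) (∈-allFin v)

  ∈-fibre⁻ : ∀ {v j} → v ∈ fibre part j → part v ≡ j
  ∈-fibre⁻ {j = j} v∈ = proj₂ (∈-filter⁻ (λ u → part u ≟ j) {xs = allFin n} v∈)

  Unique-fibre : ∀ j → Unique (fibre part j)
  Unique-fibre j = Unique.filter⁺ (λ u → part u ≟ j) (Unique.allFin⁺ n)

  fibrewiseLabelling : ∀ {B : Set} → B → (P : Fin t → List B) →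
    (∀ j → length (fibre part j) ≡ length (P j)) →
    Σ (Fin n → B) (λ ℓ → ∀ j → map ℓ (fibre part j) ≡ P j)
  fibrewiseLabelling {B} default P len = ℓ , map-ℓ
    where
    open Relabel _≟_ default
    ℓ : Fin n → B
    ℓ v = relabel (fibre part (part v)) (P (part v)) v
    ℓ-on-fibre : ∀ {j v} → part v ≡ j → ℓ v ≡ relabel (fibre part j) (P j) v
    ℓ-on-fibre refl = refl
    map-ℓ : ∀ j → map ℓ (fibre part j) ≡ P j
    map-ℓ j = trans (map-cong-local (All.tabulate (λ v∈ → ℓ-on-fibre (∈-fibre⁻ v∈))))
                    (map-relabel (Unique-fibre j) (len j))

  fibrewise-∈ : ∀ {B : Set} {ℓ : Fin n → B} {P : Fin t → List B} →
    (∀ j → map ℓ (fibre part j) ≡ P j) → ∀ v → ℓ v ∈ P (part v)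
  fibrewise-∈ {ℓ = ℓ} map-ℓ v = subst (ℓ v ∈_) (map-ℓ (part v)) (∈-map⁺ ℓ (∈-fibre⁺ refl))

  fibrewise-injective : ∀ {B : Set} {ℓ : Fin n → B} {P : Fin t → List B} (colour : B → Fin t) →
    (∀ j → Unique (P j)) → (∀ {j b} → b ∈ P j → colour b ≡ j) →
    (∀ j → map ℓ (fibre part j) ≡ P j) → ∀ u v → ℓ u ≡ ℓ v → u ≡ v
  fibrewise-injective {ℓ = ℓ} colour uniqP colour-∈ map-ℓ u v ℓu≡ℓv =
    Unique-map⇒injectiveOn (subst Unique (sym (map-ℓ (part u))) (uniqP (part u)))
      (∈-fibre⁺ refl) (∈-fibre⁺ (sym same-fibre)) ℓu≡ℓv
    where
    same-fibre : part u ≡ part v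
    same-fibre = begin
      part u       ≡⟨ colour-∈ (fibrewise-∈ map-ℓ u) ⟨
      colour (ℓ u) ≡⟨ cong colour ℓu≡ℓv ⟩
      colour (ℓ v) ≡⟨ colour-∈ (fibrewise-∈ map-ℓ v) ⟩
      part v       ∎
      where open ≡-Reasoning

module _ {m t} (0# : Fin m) (S : Fin m → Fin t) where

  ∈-partElems⁺ : ∀ {g} → g ≢ 0# → g ∈ partElems 0# S (S g)
  ∈-partElems⁺ {g} g≢0 =
    ∈-filter⁺ (λ h → S h ≟ S g) (∈-filter⁺ (λ h → ¬? (h ≟ 0#)) (∈-allFin g) g≢0) refl

  ∈-partElems⁻ : ∀ {g j} → g ∈ partElems 0# S j → g ≢ 0# × S g ≡ j
  ∈-partElems⁻ {j = j} g∈ with ∈-filter⁻ (λ h → S h ≟ j) g∈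
  ... | g∈Γ* , Sg≡j = proj₂ (∈-filter⁻ (λ h → ¬? (h ≟ 0#)) {xs = allFin m} g∈Γ*) , Sg≡j

  Unique-partElems : ∀ j → Unique (partElems 0# S j)
  Unique-partElems j =
    Unique.filter⁺ (λ h → S h ≟ j) (Unique.filter⁺ (λ h → ¬? (h ≟ 0#)) (Unique.allFin⁺ m))

module ListSum {A : Set} {_∙_ : A → A → A} {ε : A} (isCM : IsCommutativeMonoid _≡_ _∙_ ε) where
  open IsCommutativeMonoid isCM using (assoc; comm; identityˡ; identityʳ)

  sumOver : ∀ {X : Set} → (X → A) → List X → A
  sumOver f xs = foldr _∙_ ε (map f xs)

  masked : ∀ {X : Set} {P : X → Set} → Decidable P → (X → A) → X → A
  masked P? f x = if does (P? x) then f x else ε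

  masked-∈ : ∀ {X : Set} {P : X → Set} (P? : Decidable P) (f : X → A) {x} → P x → masked P? f x ≡ f x
  masked-∈ P? f {x} px with P? x
  ... | yes _  = refl
  ... | no ¬px = ⊥-elim (¬px px)

  masked-∉ : ∀ {X : Set} {P : X → Set} (P? : Decidable P) (f : X → A) {x} → ¬ P x → masked P? f x ≡ ε
  masked-∉ P? f {x} ¬px with P? x
  ... | yes px = ⊥-elim (¬px px)
  ... | no _   = refl

  sumOver-ε : ∀ {X : Set} {f : X → A} {xs} → All (λ x → f x ≡ ε) xs → sumOver f xs ≡ ε
  sumOver-ε All.[]           = refl
  sumOver-ε (fx≡ε ∷ fxs≡ε) = trans (cong₂ _∙_ fx≡ε (sumOver-ε fxs≡ε)) (identityˡ ε)

  sumOver-cong : ∀ {X : Set} {f g : X → A} xs → (∀ x → f x ≡ g x) → sumOver f xs ≡ sumOver g xs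
  sumOver-cong xs f≡g = cong (foldr _∙_ ε) (map-cong-local (All.universal f≡g xs))

  interchange : ∀ a b c d → (a ∙ b) ∙ (c ∙ d) ≡ (a ∙ c) ∙ (b ∙ d)
  interchange a b c d = begin
    (a ∙ b) ∙ (c ∙ d) ≡⟨ assoc a b (c ∙ d) ⟩
    a ∙ (b ∙ (c ∙ d)) ≡⟨ cong (a ∙_) (sym (assoc b c d)) ⟩
    a ∙ ((b ∙ c) ∙ d) ≡⟨ cong (λ e → a ∙ (e ∙ d)) (comm b c) ⟩
    a ∙ ((c ∙ b) ∙ d) ≡⟨ cong (a ∙_) (assoc c b d) ⟩
    a ∙ (c ∙ (b ∙ d)) ≡⟨ sym (assoc a c (b ∙ d)) ⟩
    (a ∙ c) ∙ (b ∙ d) ∎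
    where open ≡-Reasoning

  sumOver-∙ : ∀ {X : Set} (f g : X → A) xs →
    sumOver (λ x → f x ∙ g x) xs ≡ sumOver f xs ∙ sumOver g xs
  sumOver-∙ f g []       = sym (identityˡ ε)
  sumOver-∙ f g (x ∷ xs) =
    trans (cong ((f x ∙ g x) ∙_) (sumOver-∙ f g xs)) (interchange _ _ _ _)

  sumOver-filter : ∀ {X : Set} {P : X → Set} (P? : Decidable P) (f : X → A) xs →
    sumOver f (filter P? xs) ≡ sumOver (masked P? f) xs
  sumOver-filter P? f []       = refl
  sumOver-filter P? f (x ∷ xs) with does (P? x)
  ... | true  = cong (f x ∙_) (sumOver-filter P? f xs)
  ... | false = trans (sumOver-filter P? f xs) (sym (identityˡ _))

  sumOver-supportedAt : ∀ {X : Set} {f : X → A} {xs v} → Unique xs → v ∈ xs →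
    (∀ x → x ≢ v → f x ≡ ε) → sumOver f xs ≡ f v
  sumOver-supportedAt {f = f} {x ∷ xs} (x∉xs ∷ _) (here refl) f≡ε =
    trans (cong (f x ∙_) (sumOver-ε (All.map (λ x≢y → f≡ε _ (≢-sym x≢y)) x∉xs))) (identityʳ (f x))
  sumOver-supportedAt {f = f} {x ∷ xs} (x∉xs ∷ uniq) (there v∈) f≡ε =
    trans (cong₂ _∙_ (f≡ε x (λ x≡v → All.lookup x∉xs v∈ x≡v)) (sumOver-supportedAt uniq v∈ f≡ε))
          (identityˡ _)

  sumOver-fibres : ∀ {X : Set} {t} (part : X → Fin t) (f : X → A) xs →
    sumOver f xs ≡ sumOver (λ j → sumOver (masked (λ x → part x ≟ j) f) xs) (allFin t)
  sumOver-fibres {t = t} part f [] = sym (sumOver-ε (All.universal (λ _ → refl) (allFin t)))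
  sumOver-fibres {t = t} part f (x ∷ xs) = begin
    f x ∙ sumOver f xs
      ≡⟨ cong₂ _∙_ (sym x-in-own-fibre) (sumOver-fibres part f xs) ⟩
    sumOver (λ j → masked (λ y → part y ≟ j) f x) (allFin t) ∙
      sumOver (λ j → sumOver (masked (λ y → part y ≟ j) f) xs) (allFin t)
      ≡⟨ sym (sumOver-∙ _ _ (allFin t)) ⟩
    sumOver (λ j → sumOver (masked (λ y → part y ≟ j) f) (x ∷ xs)) (allFin t) ∎
    where
    open ≡-Reasoning
    x-in-own-fibre : sumOver (λ j → masked (λ y → part y ≟ j) f x) (allFin t) ≡ f x
    x-in-own-fibre = trans
      (sumOver-supportedAt (Unique.allFin⁺ t) (∈-allFin (part x)) outside)
      (masked-∈ (λ y → part y ≟ part x) f refl)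
      where
      outside : ∀ j → j ≢ part x → masked (λ y → part y ≟ j) f x ≡ ε
      outside j j≢px = masked-∉ (λ y → part y ≟ j) f (≢-sym j≢px)

module _ {n} (G : SimpleGraph n) where

  closedNbhd? : ∀ v → Decidable (InClosedNbhd G v)
  closedNbhd? v u = (u ≟ v) ⊎-dec T? (adj G v u)

  Adj-sym : ∀ {u v} → Adj G u v → Adj G v u
  Adj-sym {u} {v} = subst T (symm G u v)

  InClosedNbhd-twin : ∀ {X} → IsTrueTwinSet G X → ∀ {u u' v} → X u → X u' →
    InClosedNbhd G v u → InClosedNbhd G v u'
  InClosedNbhd-twin twins {u} {u'} {v} Xu Xu' u∈N[v] with u ≟ u'
  ... | yes refl = u∈N[v]
  ... | no u≢u' with twins u u' Xu Xu' u≢u' | u∈N[v]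
  ...   | adj-uu' , _    | inj₁ refl = inj₂ adj-uu'
  ...   | _       , same | inj₂ adj-vu
          with Equivalence.to (same v) (inj₂ (Adj-sym adj-vu))
  ...     | inj₁ v≡u'      = inj₁ (sym v≡u')
  ...     | inj₂ adj-u'v   = inj₂ (Adj-sym adj-u'v)

module _ {A : Set} {_∙_ : A → A → A} {ε : A} (isCM : IsCommutativeMonoid _≡_ _∙_ ε) where
  open ListSum isCM

  sumOver-closedNbhd : ∀ {n t} (G : SimpleGraph n) (part : Fin n → Fin t) →
    (∀ j → IsTrueTwinSet G (λ v → part v ≡ j)) →
    (ℓ : Fin n → A) → (∀ j → sumOver ℓ (fibre part j) ≡ ε) →
    ∀ v → sumOver (masked (closedNbhd? G v) ℓ) (allFin n) ≡ ε
  sumOver-closedNbhd {n} {t} G part twins ℓ fibre-sums v =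
    trans (sumOver-fibres part _ (allFin n)) (sumOver-ε (All.universal fibre∩N[v] (allFin t)))
    where
    ℓ↾N[v] : Fin n → A
    ℓ↾N[v] = masked (closedNbhd? G v) ℓ
    fibre∩N[v] : ∀ j → sumOver (masked (λ u → part u ≟ j) ℓ↾N[v]) (allFin n) ≡ ε
    fibre∩N[v] j with any? (λ u → (part u ≟ j) ×-dec closedNbhd? G v u)
    ... | yes (u , pu≡j , u∈N[v]) = begin
      sumOver (masked (λ w → part w ≟ j) ℓ↾N[v]) (allFin n) ≡⟨ sumOver-cong (allFin n) fibre⊆N[v] ⟩
      sumOver (masked (λ w → part w ≟ j) ℓ) (allFin n)      ≡⟨ sym (sumOver-filter (λ w → part w ≟ j) ℓ (allFin n)) ⟩
      sumOver ℓ (fibre part j)                              ≡⟨ fibre-sums j ⟩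
      ε                                                     ∎
      where
      open ≡-Reasoning
      fibre⊆N[v] : ∀ w → masked (λ w → part w ≟ j) ℓ↾N[v] w ≡ masked (λ w → part w ≟ j) ℓ w
      fibre⊆N[v] w with part w ≟ j
      ... | no _     = refl
      ... | yes pw≡j = masked-∈ (closedNbhd? G v) ℓ (InClosedNbhd-twin G (twins j) pu≡j pw≡j u∈N[v])
    ... | no disjoint = sumOver-ε (All.universal outside (allFin n))
      where
      outside : ∀ w → masked (λ w → part w ≟ j) ℓ↾N[v] w ≡ ε
      outside w with part w ≟ j
      ... | no _     = refl
      ... | yes pw≡j = masked-∉ (closedNbhd? G v) ℓ (λ w∈N[v] → disjoint (w , pw≡j , w∈N[v]))

module _ {m} {_⊕_ : Fin m → Fin m → Fin m} {0# : Fin m} (isCM : IsCommutativeMonoid _≡_ _⊕_ 0#) where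
  open ListSum isCM
  open IsCommutativeMonoid isCM using (identityˡ; identityʳ)

  label⊕weight : ∀ {n} (G : SimpleGraph n) (ℓ : Fin n → Fin m) v →
    ℓ v ⊕ weight G _⊕_ 0# ℓ v ≡ sumOver (masked (closedNbhd? G v) ℓ) (allFin n)
  label⊕weight {n} G ℓ v = begin
    ℓ v ⊕ weight G _⊕_ 0# ℓ v
      ≡⟨ cong₂ _⊕_ (sym label-as-sum) (sumOver-filter (λ u → T? (adj G v u)) ℓ (allFin n)) ⟩
    sumOver (masked (_≟ v) ℓ) (allFin n) ⊕ sumOver (masked (λ u → T? (adj G v u)) ℓ) (allFin n)
      ≡⟨ sumOver-∙ _ _ (allFin n) ⟨
    sumOver (λ u → masked (_≟ v) ℓ u ⊕ masked (λ u → T? (adj G v u)) ℓ u) (allFin n)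
      ≡⟨ sumOver-cong (allFin n) self-or-neighbour ⟩
    sumOver (masked (closedNbhd? G v) ℓ) (allFin n) ∎
    where
    open ≡-Reasoning
    label-as-sum : sumOver (masked (_≟ v) ℓ) (allFin n) ≡ ℓ v
    label-as-sum = trans
      (sumOver-supportedAt (Unique.allFin⁺ n) (∈-allFin v) (λ u → masked-∉ (_≟ v) ℓ))
      (masked-∈ (_≟ v) ℓ refl)
    self-or-neighbour : ∀ u → masked (_≟ v) ℓ u ⊕ masked (λ u → T? (adj G v u)) ℓ u
                              ≡ masked (closedNbhd? G v) ℓ u
    self-or-neighbour u with u ≟ v
    ... | yes refl rewrite irrefl G u = identityʳ (ℓ u)
    ... | no _                        = identityˡ _

module _ {m} {_⊕_ : Fin m → Fin m → Fin m} {0# : Fin m} {⊖_ : Fin m → Fin m}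
         (isAG : IsAbelianGroup _≡_ _⊕_ 0# ⊖_) where
  open IsAbelianGroup isAG using (isGroup; isCommutativeMonoid)
  open ListSum isCommutativeMonoid using (sumOver)

  group : Group _ _
  group = record { isGroup = isGroup }

  open GroupProperties group using (inverseʳ-unique)

  weight≡⊖label : ∀ {n t} (G : SimpleGraph n) (part : Fin n → Fin t) →
    (∀ j → IsTrueTwinSet G (λ v → part v ≡ j)) →
    (ℓ : Fin n → Fin m) → (∀ j → sumOver ℓ (fibre part j) ≡ 0#) →
    ∀ v → weight G _⊕_ 0# ℓ v ≡ ⊖ ℓ v
  weight≡⊖label G part twins ℓ fibre-sums v = inverseʳ-unique (ℓ v) _
    (trans (label⊕weight isCommutativeMonoid G ℓ v)
           (sumOver-closedNbhd isCommutativeMonoid G part twins ℓ fibre-sums v))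

proposition4p8 :
    (n m t : ℕ) → 1 ≤ t →
    (G : SimpleGraph n) →
    (_⊕_ : Fin m → Fin m → Fin m) (0# : Fin m) (⊖_ : Fin m → Fin m) →
    IsAbelianGroup _≡_ _⊕_ 0# ⊖_ →
    (part : Fin n → Fin t) →
    (∀ i → IsTrueTwinSet G (λ v → part v ≡ i)) →
    sum (map (partSize part) (allFin t)) + 1 ≡ m →
    (S : Fin m → Fin t) →
    (∀ i → length (partElems 0# S i) ≡ partSize part i) →
    (∀ i → sumG _⊕_ 0# (partElems 0# S i) ≡ 0#) →
    Σ (Fin n → Fin m) (λ ℓ → IsDistanceAntiMagic G _⊕_ 0# ℓ)
proposition4p8 n m t _ G _⊕_ 0# ⊖_ isAG part twins _ S |Sᵢ|≡|Vᵢ| ΣSᵢ≡0 =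
  ℓ , ℓ-injective , ℓ≢0 , ℓ-onto-Γ* , weight-injective
  where
  open GroupProperties (group isAG) using (⁻¹-injective)

  labelling : Σ (Fin n → Fin m) (λ ℓ → ∀ j → map ℓ (fibre part j) ≡ partElems 0# S j)
  labelling = fibrewiseLabelling part 0# (partElems 0# S) (λ j → sym (|Sᵢ|≡|Vᵢ| j))

  ℓ : Fin n → Fin m
  ℓ = proj₁ labelling

  map-ℓ : ∀ j → map ℓ (fibre part j) ≡ partElems 0# S j
  map-ℓ = proj₂ labelling

  ℓ-injective : ∀ u v → ℓ u ≡ ℓ v → u ≡ v
  ℓ-injective = fibrewise-injective part S (Unique-partElems 0# S)
    (λ g∈ → proj₂ (∈-partElems⁻ 0# S g∈)) map-ℓ

  ℓ≢0 : ∀ v → ℓ v ≢ 0#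
  ℓ≢0 v = proj₁ (∈-partElems⁻ 0# S (fibrewise-∈ part map-ℓ v))

  ℓ-onto-Γ* : ∀ g → g ≢ 0# → Σ (Fin n) (λ v → ℓ v ≡ g)
  ℓ-onto-Γ* g g≢0 with ∈-map⁻ ℓ (subst (g ∈_) (sym (map-ℓ (S g))) (∈-partElems⁺ 0# S g≢0))
  ... | v , _ , g≡ℓv = v , sym g≡ℓv

  weight≡⊖ℓ : ∀ v → weight G _⊕_ 0# ℓ v ≡ ⊖ ℓ v
  weight≡⊖ℓ = weight≡⊖label isAG G part twins ℓ
    (λ j → trans (cong (foldr _⊕_ 0#) (map-ℓ j)) (ΣSᵢ≡0 j))

  weight-injective : ∀ u v → weight G _⊕_ 0# ℓ u ≡ weight G _⊕_ 0# ℓ v → u ≡ v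
  weight-injective u v w≡w =
    ℓ-injective u v (⁻¹-injective (trans (sym (weight≡⊖ℓ u)) (trans w≡w (weight≡⊖ℓ v))))
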